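{- Let $G$ be a finite connected directed graph with all (undirected) degrees at most $D$, and let $\chi_G:E(G)\to K$ be the decoration defined in the context. Then $\chi_G$ is injective. Moreover, the map $\tau_G:V(G)\to\Omega$, $\tau_G(v)=$ the class of $(G,v,\chi_G)$, is injective, and for any $x_1,x_2\in V(G)$ the directed edge $x_1\to x_2$ belongs to $E(G)$ if and only if $\tau_G(x_1)\to\tau_G(x_2)$ belongs to $E$; that is, $\tau_G$ is an isomorphism from $G$ onto the subgraph of $(\Omega,E)$ induced on $\tau_G(V(G))$.
   Context: For a finite directed graph $G$ (orientations ignored for ranks), $\rho_G(F)=\frac{1}{|V(G)|}(|V(G)|-c(F))$ for $F\subseteq E(G)$, where $c(F)$ is the number of components of $(V(G),F)$. For a $k$-edge-coloring $\alpha:E(G)\to[k]$ (arbitrary map), $\rho_{G,\alpha}=(\rho_G(\alpha^{ -1}(A)))_{A\subseteq[k]}\in\mathbb{R}^{2^k}$, and $d_k(\alpha,\beta)$ is the Euclidean distance between $\rho_{G,\alpha}$ and $\rho_{G,\beta}$. Fix positive integers $M(k,n)$ ($k,n\ge1$) such that for every finite directed graph $G$ there is a list of $M(k,n)$ $k$-edge-colorings of $G$ forming a $2^{ -n}$-net (every $k$-edge-coloring $\beta$ has $d_k$-distance at most $2^{ -n}$ from some member). For each isomorphism class (of directed graphs) fix a representative $G_0$ and, for every $k,n$, such a list $A_{G_0,k,n}=(\alpha_1,\dots,\alpha_{M(k,n)})$; for each $H$ in the class fix an isomorphism $\varphi_H:H\to G_0$ (with $\varphi_{G_0}$ the identity)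 and set $A_{H,k,n}=(\alpha_1\circ\varphi_H,\dots,\alpha_{M(k,n)}\circ\varphi_H)$ (where $\varphi_H$ acts on edges). Let $K=\prod_{k,n\ge1}[k]^{M(k,n)}$ and define $\chi_G:E(G)\to K$ by $\chi_G(e)=(\alpha(e))_{k,n\ge 1,\ \alpha\in A_{G,k,n}}$. For $m\ge1$ let $P_m:K\to\prod_{k,n=1}^m[k]^{M(k,n)}$ be the projection. $\Omega$ is the set of equivalence classes of triples $(H,v,\chi)$ with $H$ a countable connected directed graph of degrees at most $D$, $v\in V(H)$, $\chi:E(H)\to K$, where two triples are equivalent if there is a bijection of vertex sets mapping root to root, preserving directed edges both ways, and preserving decorations. The directed edge set $E$ on $\Omega$: there is an edge from the class of $(G_1,v_1,\chi_1)$ to the class of $(G_2,v_2,\chi_2)$ iff there are a countable connected directed graph $H$ of degrees at most $D$, a directed edge $u\to u'$ of $H$ and $\chi:E(H)\to K$ with $(H,u,\chi)$ equivalent to $(G_1,v_1,\chi_1)$ and $(H,u',\chi)$ equivalent to $(G_2,v_2,\chi_2)$. -}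

module Defs where

open import Level using (Level)
open import Data.Nat as ℕ using (ℕ; zero; suc; _∸_; _<ᵇ_)
open import Data.Fin as Fin using (Fin; toℕ)
open import Data.Bool using (Bool; true; false; T; _∧_; _∨_; not)
open import Data.Vec as Vec using (Vec; lookup; []; _∷_)
open import Data.List as List using (List; length)
open import Data.List.Relation.Unary.All using (All)
open import Data.List.Relation.Unary.Unique.Propositional using (Unique)
open import Data.Product using (Σ; _×_; _,_; proj₁; proj₂)
open import Data.Sum using (_⊎_)
open import Relation.Nullary.Decidable using (⌊_⌋)
open import Relation.Binary.PropositionalEquality using (_≡_; subst; sym)
open import Data.Integer using (+_)
open import Data.Rational as ℚ using (ℚ; 0ℚ; 1ℚ)

record FinDigraph : Set where
  constructor mkDigraph
  field
    size : ℕ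
    mat  : Vec (Vec Bool size) size
open FinDigraph public

Vtx : FinDigraph → Set
Vtx G = Fin (size G)

Adj : (G : FinDigraph) → Vtx G → Vtx G → Bool
Adj G i j = lookup (lookup (mat G) i) j

Edge : FinDigraph → Set
Edge G = Σ (Vtx G × Vtx G) (λ p → T (Adj G (proj₁ p) (proj₂ p)))

-- directed graphs are loopless (convention)
Loopless : FinDigraph → Set
Loopless G = ∀ i → Adj G i i ≡ false

Coloring : FinDigraph → ℕ → Set
Coloring G k = Edge G → Fin k

anyFin : (n : ℕ) → (Fin n → Bool) → Bool
anyFin zero    f = false
anyFin (suc n) f = f Fin.zero ∨ anyFin n (λ i → f (Fin.suc i))

countFin : (n : ℕ) → (Fin n → Bool) → ℕ
countFin zero    f = zero
countFin (suc n) f = if′ (f Fin.zero) ℕ.+ countFin n (λ i → f (Fin.suc i))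
  where
  if′ : Bool → ℕ
  if′ true  = 1
  if′ false = 0

guard : (b : Bool) → (T b → Bool) → Bool
guard true  f = f _
guard false f = false

inF : (G : FinDigraph) → (Edge G → Bool) → Vtx G → Vtx G → Bool
inF G F u w = guard (Adj G u w) (λ p → F ((u , w) , p))

stepF : (G : FinDigraph) → (Edge G → Bool) → Vtx G → Vtx G → Bool
stepF G F u w = inF G F u w ∨ inF G F w u

reachIn : (G : FinDigraph) → (Edge G → Bool) → ℕ → Vtx G → Vtx G → Bool
reachIn G F zero    v w = ⌊ v Fin.≟ w ⌋
reachIn G F (suc t) v w =
  reachIn G F t v w ∨ anyFin (size G) (λ u → reachIn G F t v u ∧ stepF G F u w)

sameComponent : (G : FinDigraph) → (Edge G → Bool) → Vtx G → Vtx G → Bool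
sameComponent G F v w = reachIn G F (size G) v w

isLeader : (G : FinDigraph) → (Edge G → Bool) → Vtx G → Bool
isLeader G F v = not (anyFin (size G) (λ w → (toℕ w <ᵇ toℕ v) ∧ sameComponent G F w v))

components : (G : FinDigraph) → (Edge G → Bool) → ℕ
components G F = countFin (size G) (isLeader G F)

-- ρ_G(F) = (|V| - c(F)) / |V|   (set to 0 for the empty graph)
rank : (G : FinDigraph) → (Edge G → Bool) → ℚ
rank (mkDigraph zero m)    F = 0ℚ
rank (mkDigraph (suc s) m) F =
  (+ (suc s ∸ components (mkDigraph (suc s) m) F)) ℚ./ suc s

allSubsets : (k : ℕ) → List (Vec Bool k)
allSubsets zero    = [] List.∷ List.[]
allSubsets (suc k) = List.map (true ∷_) (allSubsets k) List.++ List.map (false ∷_) (allSubsets k)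

preimage : {G : FinDigraph} {k : ℕ} → Coloring G k → Vec Bool k → Edge G → Bool
preimage α A e = lookup A (α e)

sumℚ : List ℚ → ℚ
sumℚ = List.foldr ℚ._+_ 0ℚ

distSq : (G : FinDigraph) (k : ℕ) → Coloring G k → Coloring G k → ℚ
distSq G k α β = sumℚ (List.map term (allSubsets k))
  where
  term : Vec Bool k → ℚ
  term A = let d = rank G (preimage {G} α A) ℚ.- rank G (preimage {G} β A) in d ℚ.* d

half^ : ℕ → ℚ
half^ zero    = 1ℚ
half^ (suc n) = ((+ 1) ℚ./ 2) ℚ.* half^ n

-- a list (indexed by Fin m) of k-colourings is a 2^{-n}-net:
-- d_k(α_i, β) ≤ 2^{-n}, expressed as d_k² ≤ (2^{-n})²
IsNet : (G : FinDigraph) (k n m : ℕ) → (Fin m → Coloring G k) → Set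
IsNet G k n m α = ∀ (β : Coloring G k) → Σ (Fin m) (λ i → distSq G k (α i) β ℚ.≤ half^ n ℚ.* half^ n)

record FinIso (G H : FinDigraph) : Set where
  field
    to       : Vtx G → Vtx H
    from     : Vtx H → Vtx G
    from-to  : ∀ x → from (to x) ≡ x
    to-from  : ∀ y → to (from y) ≡ y
    pres     : ∀ i j → Adj H (to i) (to j) ≡ Adj G i j
open FinIso public

isoEdge : {G H : FinDigraph} → FinIso G H → Edge G → Edge H
isoEdge φ ((i , j) , p) = (to φ i , to φ j) , subst T (sym (pres φ i j)) p

-- The construction data.  Indices are shifted: the paper's k,n ≥ 1 are
-- suc k, suc n here.  M k n is the paper's M(k,n) (only used at k,n ≥ 1).

K : (ℕ → ℕ → ℕ) → Set
K M = (k n : ℕ) → Fin (M (suc k) (suc n)) → Fin (suc k)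

_≈K_ : {M : ℕ → ℕ → ℕ} → K M → K M → Set
_≈K_ {M} a b = ∀ k n (i : Fin (M (suc k) (suc n))) → a k n i ≡ b k n i

record Setup : Set where
  field
    M        : ℕ → ℕ → ℕ
    M-pos    : ∀ k n → 1 ℕ.≤ M (suc k) (suc n)
    rep      : FinDigraph → FinDigraph
    φ        : ∀ H → FinIso H (rep H)
    rep-inv  : ∀ H H′ → FinIso H H′ → rep H ≡ rep H′
    rep-idem : ∀ H → rep (rep H) ≡ rep H
    φ-id     : ∀ H (v : Vtx (rep H)) → toℕ (to (φ (rep H)) v) ≡ toℕ v
    A        : (H : FinDigraph) (k n : ℕ) → Fin (M (suc k) (suc n)) → Coloring H (suc k)
    A-net    : ∀ H k n → IsNet (rep H) (suc k) (suc n) (M (suc k) (suc n)) (A (rep H) k n)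
    A-transp : ∀ H k n i (e : Edge H) → A H k n i e ≡ A (rep H) k n i (isoEdge (φ H) e)
open Setup public

χ : (S : Setup) (G : FinDigraph) → Edge G → K (M S)
χ S G e k n i = A S G k n i e

record CDigraph : Set₁ where
  field
    V       : Set
    enc     : V → ℕ
    enc-inj : ∀ x y → enc x ≡ enc y → x ≡ y
    adj     : V → V → Bool
open CDigraph public

CEdge : CDigraph → Set
CEdge H = Σ (V H × V H) (λ p → T (adj H (proj₁ p) (proj₂ p)))

CLoopless : CDigraph → Set
CLoopless H = ∀ x → adj H x x ≡ false

data Walk (H : CDigraph) : V H → V H → Set where
  stay : ∀ {x} → Walk H x x
  fwd  : ∀ {x y z} → T (adj H x y) → Walk H y z → Walk H x z
  bwd  : ∀ {x y z} → T (adj H y x) → Walk H y z → Walk H x z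

Connected : CDigraph → Set
Connected H = ∀ x y → Walk H x y

Incident : (H : CDigraph) → V H → CEdge H → Set
Incident H v e = proj₁ (proj₁ e) ≡ v ⊎ proj₂ (proj₁ e) ≡ v

DegreeBound : ℕ → CDigraph → Set
DegreeBound D H = ∀ v (l : List (CEdge H)) → Unique l → All (Incident H v) l → length l ℕ.≤ D

Admissible : ℕ → CDigraph → Set
Admissible D H = CLoopless H × Connected H × DegreeBound D H

toC : FinDigraph → CDigraph
toC G = record { V = Vtx G ; enc = toℕ ; enc-inj = λ x y → Fin.toℕ-injective ; adj = Adj G }
  where import Data.Fin.Properties as Fin

record Rooted (M : ℕ → ℕ → ℕ) : Set₁ where
  constructor rooted
  field
    graph : CDigraph
    root  : V graph
    deco  : CEdge graph → K M
open Rooted public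

record RootedIso {M : ℕ → ℕ → ℕ} (R₁ R₂ : Rooted M) : Set where
  field
    f      : V (graph R₁) → V (graph R₂)
    g      : V (graph R₂) → V (graph R₁)
    g-f    : ∀ x → g (f x) ≡ x
    f-g    : ∀ y → f (g y) ≡ y
    f-root : f (root R₁) ≡ root R₂
    f-adj  : ∀ x y → adj (graph R₂) (f x) (f y) ≡ adj (graph R₁) x y
    f-deco : ∀ (e : CEdge (graph R₁)) →
             _≈K_ {M} (deco R₂ ((f (proj₁ (proj₁ e)) , f (proj₂ (proj₁ e))) ,
                                 subst T (sym (f-adj (proj₁ (proj₁ e)) (proj₂ (proj₁ e)))) (proj₂ e)))
                      (deco R₁ e)

-- the directed edge relation E on Ω (on representatives of classes)
ΩEdge : {M : ℕ → ℕ → ℕ} → ℕ → Rooted M → Rooted M → Set₁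
ΩEdge {M} D R₁ R₂ =
  Σ CDigraph λ H → Admissible D H ×
  Σ (V H) λ u → Σ (V H) λ u′ → T (adj H u u′) ×
  Σ (CEdge H → K M) λ c → RootedIso (rooted H u c) R₁ × RootedIso (rooted H u′ c) R₂

τ : (S : Setup) (G : FinDigraph) → Vtx G → Rooted (M S)
τ S G v = rooted (toC G) v (χ S G)

{-# OPTIONS --safe #-}
-- Let R be the representative of G, with s vertices, and β the injective colouring of
-- its edges by their codes, with s² + 1 colours. A member α of the 2^-(s+1)-net of
-- (s² + 1)-colourings of R near β uses every colour β e: otherwise the colour class
-- {β e} has α-rank 0 but β-rank at least 1/s > 2^-(s+1), since R is loopless. Hence
-- α ∘ h = β for some h, which is then injective, so bijective on the finite set E(R),
-- and α is injective. Transporting along φ_G, χ_G is injective. A decorated isomorphism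
-- into (G, x, χ_G) therefore maps each edge to the unique edge of G of the same colour:
-- from (G, v, χ_G) it fixes every edge, so by connectivity it fixes v, and an Ω-edge
-- τ_G(x₁) → τ_G(x₂), coming from an edge u → u′ of some H, has its two images in G
-- equal, giving the edge x₁ → x₂.
module Submission where

open import Defs
open import Data.Bool using (Bool; true; false; T; not; _∧_; _∨_)
open import Data.Bool.Properties using (T?; T-≡; T-irrelevant; ∨-zeroʳ; ∨-identityʳ; ∧-zeroʳ; ∧-identityʳ; ¬-not)
open import Data.Fin as Fin using (Fin; toℕ; combine; punchOut)
import Data.Fin.Properties as Fin
open import Data.Fin.Subset using (⁅_⁆)
open import Data.Fin.Subset.Properties using (x∈⁅x⁆; x∈⁅y⁆⇒x≡y)
open import Data.Integer using (+_; +≤+; +<+)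
import Data.Integer.Properties as ℤ
import Data.List as List
open import Data.List.Membership.Propositional using (_∈_)
open import Data.List.Membership.Propositional.Properties using (∈-++⁺ˡ; ∈-++⁺ʳ; ∈-map⁺)
open import Data.List.Relation.Unary.Any using (here; there)
open import Data.Nat as ℕ using (ℕ; zero; suc; _∸_; _<ᵇ_; s≤s)
import Data.Nat.Properties as ℕ
open import Data.Product using (Σ; ∃; _×_; _,_; proj₁; proj₂)
open import Data.Rational as ℚ using (ℚ; 0ℚ; _+_; _-_; _*_; -_; toℚᵘ)
import Data.Rational.Properties as ℚ
open import Algebra.Properties.Group ℚ.+-0-group using (⁻¹-involutive)
open import Data.Rational.Unnormalised as ℚᵘ using (mkℚᵘ; *≤*; *<*)
import Data.Rational.Unnormalised.Properties as ℚᵘ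
open import Data.Sum using (inj₁; inj₂)
open import Data.Vec as Vec using (Vec; lookup)
open import Data.Vec.Properties using ([]=⇒lookup; lookup⇒[]=)
open import Function using (_∘_; _↔_; Inverse; Equivalence)
open import Function.Definitions using (Injective)
open import Relation.Binary using (tri<; tri≈; tri>)
open import Relation.Nullary using (Dec; yes; no; contradiction)
open import Relation.Nullary.Decidable using (⌊_⌋; map′)
open import Relation.Binary.PropositionalEquality

anyFin-true : ∀ n (f : Fin n → Bool) i → f i ≡ true → anyFin n f ≡ true
anyFin-true (suc n) f Fin.zero    fi≡true rewrite fi≡true = refl
anyFin-true (suc n) f (Fin.suc i) fi≡true
  rewrite anyFin-true n (λ j → f (Fin.suc j)) i fi≡true = ∨-zeroʳ (f Fin.zero)

anyFin-false : ∀ n (f : Fin n → Bool) → (∀ i → f i ≡ false) → anyFin n f ≡ false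
anyFin-false zero    f f≡false = refl
anyFin-false (suc n) f f≡false
  rewrite f≡false Fin.zero = anyFin-false n (λ j → f (Fin.suc j)) (f≡false ∘ Fin.suc)

countFin-all : ∀ n (f : Fin n → Bool) → (∀ i → f i ≡ true) → countFin n f ≡ n
countFin-all zero    f f≡true = refl
countFin-all (suc n) f f≡true
  rewrite f≡true Fin.zero = cong suc (countFin-all n (λ j → f (Fin.suc j)) (f≡true ∘ Fin.suc))

countFin-≤ : ∀ n (f : Fin n → Bool) → countFin n f ℕ.≤ n
countFin-≤ zero    f = ℕ.z≤n
countFin-≤ (suc n) f with f Fin.zero
... | true  = s≤s (countFin-≤ n (λ j → f (Fin.suc j)))
... | false = ℕ.m≤n⇒m≤1+n (countFin-≤ n (λ j → f (Fin.suc j)))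

countFin-< : ∀ n (f : Fin n → Bool) i → f i ≡ false → countFin n f ℕ.< n
countFin-< (suc n) f Fin.zero    fi≡false rewrite fi≡false = s≤s (countFin-≤ n (λ j → f (Fin.suc j)))
countFin-< (suc n) f (Fin.suc i) fi≡false with f Fin.zero
... | true  = s≤s (countFin-< n (λ j → f (Fin.suc j)) i fi≡false)
... | false = ℕ.m≤n⇒m≤1+n (countFin-< n (λ j → f (Fin.suc j)) i fi≡false)

guard-true : ∀ b (f : T b → Bool) p → f p ≡ true → guard b f ≡ true
guard-true true f p fp≡true = fp≡true

guard-false : ∀ b (f : T b → Bool) → (∀ p → f p ≡ false) → guard b f ≡ false
guard-false true  f f≡false = f≡false _
guard-false false f f≡false = refl

<ᵇ-irrefl : ∀ n → (n <ᵇ n) ≡ false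
<ᵇ-irrefl zero    = refl
<ᵇ-irrefl (suc n) = <ᵇ-irrefl n

module _ (G : FinDigraph) (F : Edge G → Bool) where

  reachIn-refl : ∀ t v → reachIn G F t v v ≡ true
  reachIn-refl zero    v with v Fin.≟ v
  ... | yes _  = refl
  ... | no v≢v = contradiction refl v≢v
  reachIn-refl (suc t) v rewrite reachIn-refl t v = refl

  stepF⇒reachIn : ∀ t .{{_ : ℕ.NonZero t}} v w → stepF G F v w ≡ true → reachIn G F t v w ≡ true
  stepF⇒reachIn (suc t) v w step
    rewrite anyFin-true (size G) (λ u → reachIn G F t v u ∧ stepF G F u w) v
              (cong₂ _∧_ (reachIn-refl t v) step)
    = ∨-zeroʳ _

  joined-not-leader : ∀ lo hi → toℕ lo ℕ.< toℕ hi → stepF G F lo hi ≡ true → isLeader G F hi ≡ false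
  joined-not-leader lo hi lo<hi step = cong not (anyFin-true (size G) _ lo
    (cong₂ _∧_ (Equivalence.to T-≡ (ℕ.<⇒<ᵇ lo<hi))
               (stepF⇒reachIn (size G) {{Fin.nonZeroIndex lo}} lo hi step)))

  components-< : (e : Edge G) → proj₁ (proj₁ e) ≢ proj₂ (proj₁ e) → F e ≡ true →
                 components G F ℕ.< size G
  components-< ((a , b) , a→b) a≢b Fe with Fin.<-cmp a b
  ... | tri< a<b _ _ = countFin-< _ _ b (joined-not-leader a b a<b step-ab)
    where step-ab = cong (_∨ inF G F b a) (guard-true _ _ a→b Fe)
  ... | tri≈ _ a≡b _ = contradiction a≡b a≢b
  ... | tri> _ _ b<a = countFin-< _ _ a (joined-not-leader b a b<a step-ba)
    where step-ba = trans (cong (inF G F b a ∨_) (guard-true _ _ a→b Fe)) (∨-zeroʳ _)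

  module _ (F-empty : ∀ e → F e ≡ false) where

    inF-empty : ∀ u w → inF G F u w ≡ false
    inF-empty u w = guard-false (Adj G u w) _ (λ _ → F-empty _)

    stepF-empty : ∀ u w → stepF G F u w ≡ false
    stepF-empty u w = cong₂ _∨_ (inF-empty u w) (inF-empty w u)

    reachIn-empty : ∀ t v w → reachIn G F t v w ≡ ⌊ v Fin.≟ w ⌋
    reachIn-empty zero    v w = refl
    reachIn-empty (suc t) v w
      rewrite reachIn-empty t v w
            | anyFin-false (size G) (λ u → reachIn G F t v u ∧ stepF G F u w)
                (λ u → trans (cong (reachIn G F t v u ∧_) (stepF-empty u w)) (∧-zeroʳ _))
      = ∨-identityʳ _

    components-empty : components G F ≡ size G
    components-empty = countFin-all (size G) (isLeader G F) λ v →
      cong not (anyFin-false (size G) _ (no-earlier-partner v))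
      where
      no-earlier-partner : ∀ v w → (toℕ w <ᵇ toℕ v) ∧ sameComponent G F w v ≡ false
      no-earlier-partner v w rewrite reachIn-empty (size G) w v with w Fin.≟ v
      ... | yes refl = trans (∧-identityʳ _) (<ᵇ-irrefl (toℕ v))
      ... | no _     = ∧-zeroʳ _

rank-empty : ∀ G F → (∀ e → F e ≡ false) → rank G F ≡ 0ℚ
rank-empty (mkDigraph zero    m) F F-empty = refl
rank-empty G@(mkDigraph (suc s) m) F F-empty
  rewrite components-empty G F F-empty | ℕ.n∸n≡0 s = ℚ.0/n≡0 (suc s)

-- mkℚᵘ i d denotes i/(d+1); the last step amounts to n + 2 ≤ 2(n + 1).
half^≤1/suc : ∀ n → toℚᵘ (half^ n) ℚᵘ.≤ mkℚᵘ (+ 1) n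
half^≤1/suc zero    = ℚᵘ.≤-refl
half^≤1/suc (suc n) = begin
  toℚᵘ (half^ (suc n))              ≃⟨ ℚ.toℚᵘ-homo-* ((+ 1) ℚ./ 2) (half^ n) ⟩
  mkℚᵘ (+ 1) 1 ℚᵘ.* toℚᵘ (half^ n) ≤⟨ ℚᵘ.*-monoʳ-≤-nonNeg (mkℚᵘ (+ 1) 1) (half^≤1/suc n) ⟩
  mkℚᵘ (+ 1) 1 ℚᵘ.* mkℚᵘ (+ 1) n   ≤⟨ *≤* (+≤+ (s≤s (ℕ.≤-trans (ℕ.m≤n+m _ n) (ℕ.m≤m+n _ 0)))) ⟩
  mkℚᵘ (+ 1) (suc n)                ∎
  where open ℚᵘ.≤-Reasoning

half^<rank : ∀ G F n → size G ℕ.≤ n → components G F ℕ.< size G → half^ n ℚ.< rank G F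
half^<rank G@(mkDigraph (suc s) m) F n s<n c<s = ℚ.toℚᵘ-cancel-< (begin-strict
  toℚᵘ (half^ n)                         ≤⟨ half^≤1/suc n ⟩
  mkℚᵘ (+ 1) n                           <⟨ *<* (+<+ (s≤s (ℕ.+-monoˡ-≤ 0 s<n))) ⟩
  mkℚᵘ (+ 1) s                           ≤⟨ *≤* (ℤ.*-monoʳ-≤-nonNeg (+ suc s) (+≤+ (ℕ.m<n⇒0<n∸m c<s))) ⟩
  mkℚᵘ (+ (suc s ∸ components G F)) s    ≃⟨ ℚ.toℚᵘ-fromℚᵘ _ ⟨
  toℚᵘ (rank G F)                        ∎)
  where open ℚᵘ.≤-Reasoning

half^-nonNeg : ∀ n → 0ℚ ℚ.≤ half^ n
half^-nonNeg zero    = ℚ.nonNegative⁻¹ _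
half^-nonNeg (suc n) = ℚ.nonNegative⁻¹ _ {{ℚ.nonNeg*nonNeg⇒nonNeg ((+ 1) ℚ./ 2) (half^ n) {{ℚ.nonNegative (half^-nonNeg n)}}}}

square-nonNeg : ∀ p → 0ℚ ℚ.≤ p * p
square-nonNeg p with ℚ.≤-total 0ℚ p
... | inj₁ 0≤p = ℚ.nonNegative⁻¹ _ {{ℚ.nonNeg*nonNeg⇒nonNeg p {{ℚ.nonNegative 0≤p}} p {{ℚ.nonNegative 0≤p}}}}
... | inj₂ p≤0 = ℚ.nonNegative⁻¹ _ {{ℚ.nonPos*nonPos⇒nonPos p {{ℚ.nonPositive p≤0}} p {{ℚ.nonPositive p≤0}}}}

square-mono-< : ∀ {p q} → 0ℚ ℚ.≤ p → p ℚ.< q → p * p ℚ.< q * q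
square-mono-< {p} {q} 0≤p p<q = begin-strict
  p * p  ≤⟨ ℚ.*-monoʳ-≤-nonNeg p {{ℚ.nonNegative 0≤p}} (ℚ.<⇒≤ p<q) ⟩
  q * p  <⟨ ℚ.*-monoʳ-<-pos q {{ℚ.positive (ℚ.≤-<-trans 0≤p p<q)}} p<q ⟩
  q * q  ∎
  where open ℚ.≤-Reasoning

[0-q]*[0-q]≡q*q : ∀ q → (0ℚ - q) * (0ℚ - q) ≡ q * q
[0-q]*[0-q]≡q*q q = begin
  (0ℚ - q) * (0ℚ - q)  ≡⟨ cong (λ x → x * x) (ℚ.+-identityˡ (- q)) ⟩
  - q * - q            ≡⟨ ℚ.neg-distribˡ-* q (- q) ⟨
  - (q * - q)          ≡⟨ cong -_ (ℚ.neg-distribʳ-* q q) ⟨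
  - - (q * q)          ≡⟨ ⁻¹-involutive (q * q) ⟩
  q * q                ∎
  where open ≡-Reasoning

sumℚ-nonNeg : ∀ {X : Set} (f : X → ℚ) → (∀ x → 0ℚ ℚ.≤ f x) → ∀ xs → 0ℚ ℚ.≤ sumℚ (List.map f xs)
sumℚ-nonNeg f f≥0 List.[]       = ℚ.≤-refl
sumℚ-nonNeg f f≥0 (x List.∷ xs) = ℚ.+-mono-≤ (f≥0 x) (sumℚ-nonNeg f f≥0 xs)

∈⇒≤-sumℚ : ∀ {X : Set} (f : X → ℚ) → (∀ x → 0ℚ ℚ.≤ f x) → ∀ {x xs} → x ∈ xs → f x ℚ.≤ sumℚ (List.map f xs)
∈⇒≤-sumℚ f f≥0 {x} {_ List.∷ xs} (here refl) =
  subst (ℚ._≤ f x + sumℚ (List.map f xs)) (ℚ.+-identityʳ (f x)) (ℚ.+-monoʳ-≤ (f x) (sumℚ-nonNeg f f≥0 xs))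
∈⇒≤-sumℚ f f≥0 {x} {y List.∷ xs} (there x∈xs) =
  ℚ.≤-trans (∈⇒≤-sumℚ f f≥0 x∈xs)
    (subst (ℚ._≤ f y + sumℚ (List.map f xs)) (ℚ.+-identityˡ _) (ℚ.+-monoˡ-≤ (sumℚ (List.map f xs)) (f≥0 y)))

∈-allSubsets : ∀ {k} (A : Vec Bool k) → A ∈ allSubsets k
∈-allSubsets Vec.[]            = here refl
∈-allSubsets (true  Vec.∷ A) = ∈-++⁺ˡ (∈-map⁺ (true Vec.∷_) (∈-allSubsets A))
∈-allSubsets (false Vec.∷ A) = ∈-++⁺ʳ _ (∈-map⁺ (false Vec.∷_) (∈-allSubsets A))

rank-gap²≤distSq : ∀ G k (α β : Coloring G k) A →
  let d = rank G (preimage {G} α A) - rank G (preimage {G} β A) in d * d ℚ.≤ distSq G k α β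
rank-gap²≤distSq G k α β A = ∈⇒≤-sumℚ _ (λ B → square-nonNeg (gap B)) (∈-allSubsets A)
  where gap = λ B → rank G (preimage {G} α B) - rank G (preimage {G} β B)

Σ-T-≡ : ∀ {X : Set} {p : X → Bool} {x y : Σ X (T ∘ p)} → proj₁ x ≡ proj₁ y → x ≡ y
Σ-T-≡ {x = x , px} {.x , py} refl = cong (x ,_) (T-irrelevant px py)

Σ-T-any? : ∀ b {P : T b → Set} → (∀ p → Dec (P p)) → Dec (Σ (T b) P)
Σ-T-any? true  P? = map′ (_ ,_) proj₂ (P? _)
Σ-T-any? false P? = no proj₁

Edge-any? : ∀ G {P : Edge G → Set} → (∀ e → Dec (P e)) → Dec (∃ P)
Edge-any? G P? = map′
  (λ { (a , b , p , Pe) → ((a , b) , p) , Pe })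
  (λ { (((a , b) , p) , Pe) → a , b , p , Pe })
  (Fin.any? λ a → Fin.any? λ b → Σ-T-any? (Adj G a b) (λ p → P? ((a , b) , p)))

Loopless⇒endpoints-differ : ∀ G → Loopless G → (e : Edge G) → proj₁ (proj₁ e) ≢ proj₂ (proj₁ e)
Loopless⇒endpoints-differ G loopless ((a , .a) , a→a) refl = subst T (loopless a) a→a

lookup-⁅⁆-self : ∀ {k} (c : Fin k) → lookup ⁅ c ⁆ c ≡ true
lookup-⁅⁆-self c = []=⇒lookup (x∈⁅x⁆ c)

lookup-⁅⁆-other : ∀ {k} {c d : Fin k} → d ≢ c → lookup ⁅ c ⁆ d ≡ false
lookup-⁅⁆-other {c = c} {d} d≢c = ¬-not (d≢c ∘ x∈⁅y⁆⇒x≡y c ∘ lookup⇒[]= d ⁅ c ⁆)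

module _ {G : FinDigraph} (G-loopless : Loopless G) {k} (α β : Coloring G k) where

  missed-colour⇒far : ∀ n e → size G ℕ.≤ n → (∀ e′ → α e′ ≢ β e) → half^ n * half^ n ℚ.< distSq G k α β
  missed-colour⇒far n e size≤n missed = begin-strict
    half^ n * half^ n    <⟨ square-mono-< (half^-nonNeg n) (half^<rank G Fβ n size≤n
                              (components-< G Fβ e (Loopless⇒endpoints-differ G G-loopless e) (lookup-⁅⁆-self (β e)))) ⟩
    r * r                ≡⟨ [0-q]*[0-q]≡q*q r ⟨
    (0ℚ - r) * (0ℚ - r)  ≡⟨ cong (λ x → (x - r) * (x - r)) (rank-empty G Fα (λ e′ → lookup-⁅⁆-other (missed e′))) ⟨
    _                    ≤⟨ rank-gap²≤distSq G k α β ⁅ β e ⁆ ⟩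
    distSq G k α β       ∎
    where
    open ℚ.≤-Reasoning
    Fα = preimage {G} α ⁅ β e ⁆
    Fβ = preimage {G} β ⁅ β e ⁆
    r  = rank G Fβ

  close⇒colours-hit : ∀ n → size G ℕ.≤ n → distSq G k α β ℚ.≤ half^ n * half^ n →
                      ∀ e → ∃ λ e′ → α e′ ≡ β e
  close⇒colours-hit n size≤n close e with Edge-any? G (λ e′ → α e′ Fin.≟ β e)
  ... | yes hit = hit
  ... | no  miss = contradiction
    (ℚ.<-≤-trans (missed-colour⇒far n e size≤n (λ e′ eq → miss (e′ , eq))) close) (ℚ.<-irrefl refl)

Fin-injective⇒surjective : ∀ {n} {f : Fin n → Fin n} → Injective _≡_ _≡_ f → ∀ y → ∃ λ x → f x ≡ y
Fin-injective⇒surjective {suc n} {f} f-injective y with Fin.any? (λ x → f x Fin.≟ y)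
... | yes hit  = hit
... | no  miss = contradiction (Fin.injective⇒≤ punch-injective) ℕ.1+n≰n
  where
  y≢f : ∀ x → y ≢ f x
  y≢f x y≡fx = miss (x , sym y≡fx)
  punch : Fin (suc n) → Fin n
  punch x = punchOut (y≢f x)
  punch-injective : Injective _≡_ _≡_ punch
  punch-injective {x} {x′} eq = f-injective (Fin.punchOut-injective (y≢f x) (y≢f x′) eq)

module _ {X : Set} {n : ℕ} (enumeration : Fin n ↔ X) where
  open Inverse enumeration using (strictlyInverseˡ; strictlyInverseʳ) renaming (to to decode; from to encode)

  encode-injective : Injective _≡_ _≡_ encode
  encode-injective {x} {y} eq = trans (sym (strictlyInverseˡ x)) (trans (cong decode eq) (strictlyInverseˡ y))

  decode-injective : Injective _≡_ _≡_ decode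
  decode-injective {i} {j} eq = trans (sym (strictlyInverseʳ i)) (trans (cong encode eq) (strictlyInverseʳ j))

  injective⇒surjective : ∀ {f : X → X} → Injective _≡_ _≡_ f → ∀ y → ∃ λ x → f x ≡ y
  injective⇒surjective {f} f-injective y =
    let i , eq = Fin-injective⇒surjective (decode-injective ∘ f-injective ∘ encode-injective) (encode y)
    in decode i , encode-injective eq

  -- f extends to an injection of X by the identity off the subtype.
  module _ (p : X → Bool) {f : Σ X (T ∘ p) → Σ X (T ∘ p)} (f-injective : Injective _≡_ _≡_ f) where

    extend : ∀ x → Dec (T (p x)) → X
    extend x (yes px) = proj₁ (f (x , px))
    extend x (no _)   = x

    extend-injective : ∀ x y (dx : Dec (T (p x))) (dy : Dec (T (p y))) → extend x dx ≡ extend y dy → x ≡ y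
    extend-injective x y (yes px) (yes py) eq  = cong proj₁ (f-injective (Σ-T-≡ eq))
    extend-injective x y (yes px) (no ¬py) eq  = contradiction (subst (T ∘ p) eq (proj₂ (f (x , px)))) ¬py
    extend-injective x y (no ¬px) (yes py) eq  = contradiction (subst (T ∘ p) (sym eq) (proj₂ (f (y , py)))) ¬px
    extend-injective x y (no _)   (no _)   eq  = eq

    extend-preimage : ∀ x (dx : Dec (T (p x))) {y} (py : T (p y)) → extend x dx ≡ y → ∃ λ z → f z ≡ (y , py)
    extend-preimage x (yes px) py eq   = (x , px) , Σ-T-≡ eq
    extend-preimage x (no ¬px) py refl = contradiction py ¬px

    Σ-injective⇒surjective : ∀ y → ∃ λ x → f x ≡ y
    Σ-injective⇒surjective (y , py) =
      let x , eq = injective⇒surjective {f = λ x → extend x (T? (p x))}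
                     (λ {x} {x′} → extend-injective x x′ (T? (p x)) (T? (p x′))) y
      in extend-preimage x (T? (p x)) py eq

Edge-injective⇒surjective : ∀ G {h : Edge G → Edge G} → Injective _≡_ _≡_ h → ∀ e → ∃ λ e′ → h e′ ≡ e
Edge-injective⇒surjective G = Σ-injective⇒surjective Fin.*↔× (λ q → Adj G (proj₁ q) (proj₂ q))

-- h is injective, hence onto because Edge G is finite.
∘-injective⇒injective : ∀ G {C : Set} {α : Edge G → C} (h : Edge G → Edge G) →
                        Injective _≡_ _≡_ (α ∘ h) → Injective _≡_ _≡_ α
∘-injective⇒injective G {α = α} h αh-injective {x} {y} αx≡αy
  with Edge-injective⇒surjective G (αh-injective ∘ cong α) x
     | Edge-injective⇒surjective G (αh-injective ∘ cong α) y
... | a , refl | b , refl = cong h (αh-injective αx≡αy)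

close-to-injective⇒injective : ∀ {G k n} → Loopless G → size G ℕ.≤ n → {α β : Coloring G k} →
  Injective _≡_ _≡_ β → distSq G k α β ℚ.≤ half^ n * half^ n → Injective _≡_ _≡_ α
close-to-injective⇒injective {G} {n = n} loopless size≤n {α} {β} β-injective close =
  ∘-injective⇒injective G (proj₁ ∘ hit) (β-injective ∘ α∘hit≡β)
  where
  hit = close⇒colours-hit loopless α β n size≤n close
  α∘hit≡β : ∀ {e e′} → α (proj₁ (hit e)) ≡ α (proj₁ (hit e′)) → β e ≡ β e′
  α∘hit≡β {e} {e′} eq = trans (sym (proj₂ (hit e))) (trans eq (proj₂ (hit e′)))

edgeCode : ∀ G → Edge G → Fin (size G ℕ.* size G)
edgeCode G ((a , b) , _) = combine a b

edgeCode-injective : ∀ G → Injective _≡_ _≡_ (edgeCode G)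
edgeCode-injective G {(a , b) , _} {(a′ , b′) , _} eq with Fin.combine-injective a b a′ b′ eq
... | refl , refl = Σ-T-≡ refl

rep-colouring-injective : ∀ S G → Loopless (rep S G) →
  ∃ λ k → ∃ λ n → ∃ λ i → Injective _≡_ _≡_ (A S (rep S G) k n i)
rep-colouring-injective S G loopless =
  let i , close = A-net S G (s ℕ.* s) s β
  in s ℕ.* s , s , i , close-to-injective⇒injective loopless (ℕ.n≤1+n s) β-injective close
  where
  s = size (rep S G)
  β : Coloring (rep S G) (suc (s ℕ.* s))
  β = Fin.suc ∘ edgeCode (rep S G)
  β-injective : Injective _≡_ _≡_ β
  β-injective = edgeCode-injective (rep S G) ∘ Fin.suc-injective

module _ {G H : FinDigraph} (ψ : FinIso G H) where

  FinIso-to-injective : Injective _≡_ _≡_ (to ψ)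
  FinIso-to-injective {i} {j} eq = trans (sym (from-to ψ i)) (trans (cong (from ψ) eq) (from-to ψ j))

  isoEdge-injective : Injective _≡_ _≡_ (isoEdge ψ)
  isoEdge-injective eq = Σ-T-≡ (cong₂ _,_ (FinIso-to-injective (cong (proj₁ ∘ proj₁) eq))
                                          (FinIso-to-injective (cong (proj₂ ∘ proj₁) eq)))

  Loopless-transport : Loopless G → Loopless H
  Loopless-transport loopless j =
    subst (λ x → Adj H x x ≡ false) (to-from ψ j) (trans (pres ψ (from ψ j) (from ψ j)) (loopless (from ψ j)))

RootedIso-refl : ∀ {M} (R : Rooted M) → RootedIso R R
RootedIso-refl R = record
  { f = λ x → x ; g = λ x → x ; g-f = λ _ → refl ; f-g = λ _ → refl
  ; f-root = refl ; f-adj = λ _ _ → refl ; f-deco = λ _ _ _ _ → refl }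

module _ (S : Setup) (G : FinDigraph) where

  mapEdge : ∀ {R : Rooted (M S)} {x} → RootedIso R (τ S G x) → CEdge (graph R) → Edge G
  mapEdge I ((a , b) , a→b) = (f a , f b) , subst T (sym (f-adj a b)) a→b
    where open RootedIso I

  χ-injective : Loopless G → ∀ e e′ → _≈K_ {M S} (χ S G e) (χ S G e′) → e ≡ e′
  χ-injective loopless e e′ χe≈χe′ =
    let k , n , i , α-injective = rep-colouring-injective S G (Loopless-transport (φ S G) loopless)
    in isoEdge-injective (φ S G) (α-injective (begin
         A S (rep S G) k n i (isoEdge (φ S G) e)   ≡⟨ A-transp S G k n i e ⟨
         A S G k n i e                             ≡⟨ χe≈χe′ k n i ⟩
         A S G k n i e′                            ≡⟨ A-transp S G k n i e′ ⟩
         A S (rep S G) k n i (isoEdge (φ S G) e′)  ∎))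
    where open ≡-Reasoning

  module _ (loopless : Loopless G) where

    τ-iso-fixes-edges : ∀ {v w} (I : RootedIso (τ S G v) (τ S G w)) e → mapEdge I e ≡ e
    τ-iso-fixes-edges I e = χ-injective loopless _ _ (RootedIso.f-deco I e)

    τ-injective : Connected (toC G) → ∀ v w → RootedIso (τ S G v) (τ S G w) → v ≡ w
    τ-injective connected v w I with connected v w
    ... | stay      = refl
    ... | fwd v→y _ = trans (sym (cong (proj₁ ∘ proj₁) (τ-iso-fixes-edges I ((v , _) , v→y))))
                            (RootedIso.f-root I)
    ... | bwd y→v _ = trans (sym (cong (proj₂ ∘ proj₁) (τ-iso-fixes-edges I ((_ , v) , y→v))))
                            (RootedIso.f-root I)

    ΩEdge⇒Adj : ∀ {D} x₁ x₂ → ΩEdge D (τ S G x₁) (τ S G x₂) → T (Adj G x₁ x₂)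
    ΩEdge⇒Adj x₁ x₂ (H , _ , u , u′ , u→u′ , c , I₁ , I₂) =
      subst₂ (λ a b → T (Adj G a b)) (trans (cong (proj₁ ∘ proj₁) same-image) (RootedIso.f-root I₁))
        (RootedIso.f-root I₂) (proj₂ (mapEdge I₂ ε))
      where
      ε : CEdge H
      ε = (u , u′) , u→u′
      same-image : mapEdge I₂ ε ≡ mapEdge I₁ ε
      same-image = χ-injective loopless _ _ λ k n i →
        trans (RootedIso.f-deco I₂ ε k n i) (sym (RootedIso.f-deco I₁ ε k n i))

  Adj⇒ΩEdge : ∀ {D} → Admissible D (toC G) → ∀ x₁ x₂ → T (Adj G x₁ x₂) → ΩEdge D (τ S G x₁) (τ S G x₂)
  Adj⇒ΩEdge admissible x₁ x₂ x₁→x₂ =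
    toC G , admissible , x₁ , x₂ , x₁→x₂ , χ S G , RootedIso-refl (τ S G x₁) , RootedIso-refl (τ S G x₂)

lemma3p5 : (D : ℕ) (S : Setup) (G : FinDigraph) →
    Loopless G → Connected (toC G) → DegreeBound D (toC G) →
    (∀ (e e′ : Edge G) → _≈K_ {M S} (χ S G e) (χ S G e′) → e ≡ e′)
    × (∀ (v w : Vtx G) → RootedIso (τ S G v) (τ S G w) → v ≡ w)
    × (∀ (x₁ x₂ : Vtx G) →
         (T (Adj G x₁ x₂) → ΩEdge D (τ S G x₁) (τ S G x₂))
         × (ΩEdge D (τ S G x₁) (τ S G x₂) → T (Adj G x₁ x₂)))
lemma3p5 D S G loopless connected degree-bounded =
  χ-injective S G loopless ,
  τ-injective S G loopless connected ,
  λ x₁ x₂ → Adj⇒ΩEdge S G (loopless , connected , degree-bounded) x₁ x₂ , ΩEdge⇒Adj S G loopless x₁ x₂
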